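{- Let $A\subseteq\mathbb{R}^n$ be generic, and let $c\in\mathbb{R}^n$ be such that there is no $a\in A$ with $a\ll c$ (i.e. $c-\operatorname{int}\mathbb{O}^n$ contains no point of $A$). Then for every nonempty $J\subseteq\{1,\dots,n\}$ there is at most one element of $A$ in the face $c-\mathbb{O}^n_J=\{x\in\mathbb{R}^n : x\le c,\ \pi_j(x)=\pi_j(c)\text{ for all } j\in J\}$.
   Context: For $x\in\mathbb{R}^n$, $\pi_i(x)$ is its $i$-th coordinate. Order on $\mathbb{R}^n$: $x\le y$ iff $\pi_i(x)\le\pi_i(y)$ for all $i$; $x\ll y$ iff $\pi_i(x)<\pi_i(y)$ for all $i$. The supremum $\vee B$ of a nonempty subset $B\subseteq\mathbb{R}^n$ bounded above is the coordinatewise supremum. $\mathbb{O}^n=[0,\infty)^n$, $\operatorname{int}\mathbb{O}^n=(0,\infty)^n$, and for $J\subseteq\{1,\dots,n\}$, $\mathbb{O}^n_J=\{x\in\mathbb{O}^n:\pi_j(x)=0 \text{ for all } j\in J\}$. For $c\in\mathbb{R}^n$, $c-\mathbb{O}^n=\{x: x\le c\}$; its faces are the sets $c-\mathbb{O}^n_J$ for nonempty $J$, of codimension $|J|$. For a nonempty bounded-above $B$, the bonnet over $B$ is $\vee B-\mathbb{O}^n$. Given $A\subseteq\mathbb{R}^n$, a nonempty set $B\subseteq\mathbb{R}^n$ is $A$-neighborly if it is bounded above and there is no $a\in A$ with $a\ll\vee B$. $A$ is called generic if for every nonempty $A$-neighborly subset $B\subseteq A$ and every nonempty $J\subseteq\{1,\dots,n\}$,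 the face $\vee B-\mathbb{O}^n_J$ of the bonnet over $B$ contains at most one element of $A$. -}

module Defs where

open import Level using (0ℓ)
open import Data.Nat using (ℕ)
open import Data.Fin using (Fin)
open import Data.Fin.Subset using (Subset; _∈_; Nonempty)
open import Data.Product using (Σ; ∃; _×_; _,_)
open import Relation.Nullary using (¬_)
open import Relation.Binary.PropositionalEquality using (_≡_)
open import Relation.Binary.Structures using (IsTotalOrder)
open import Algebra.Structures using (IsCommutativeRing)

-- An axiomatic model of the real numbers: a Dedekind-complete ordered field
-- (unique up to isomorphism; every theorem proved here holds for ℝ).
record RealField : Set₁ where
  infix 4 _≤_ _<_
  infixl 6 _+_
  infixl 7 _*_
  field
    ℝ    : Set
    _+_  : ℝ → ℝ → ℝ
    _*_  : ℝ → ℝ → ℝ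
    -_   : ℝ → ℝ
    0#   : ℝ
    1#   : ℝ
    _≤_  : ℝ → ℝ → Set
    isCommutativeRing : IsCommutativeRing _≡_ _+_ _*_ -_ 0# 1#
    0≢1  : ¬ (0# ≡ 1#)
    inverse : ∀ x → ¬ (x ≡ 0#) → Σ ℝ λ y → x * y ≡ 1#
    isTotalOrder : IsTotalOrder _≡_ _≤_
    +-mono-≤ : ∀ {x y} z → x ≤ y → x + z ≤ y + z
    *-nonneg : ∀ {x y} → 0# ≤ x → 0# ≤ y → 0# ≤ x * y

  _<_ : ℝ → ℝ → Set
  x < y = x ≤ y × ¬ (x ≡ y)

  IsUpperBound : (ℝ → Set) → ℝ → Set
  IsUpperBound P u = ∀ x → P x → x ≤ u

  IsLUB : (ℝ → Set) → ℝ → Set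
  IsLUB P s = IsUpperBound P s × (∀ u → IsUpperBound P u → s ≤ u)

  field
    complete : (P : ℝ → Set) → (∃ λ x → P x) → (∃ λ u → IsUpperBound P u) →
               Σ ℝ λ s → IsLUB P s

module Rⁿ (R : RealField) where
  open RealField R

  -- points of ℝⁿ; π i x = x i
  Pt : ℕ → Set
  Pt n = Fin n → ℝ

  PtSet : ℕ → Set₁
  PtSet n = Pt n → Set

  _≋_ : ∀ {n} → Pt n → Pt n → Set
  x ≋ y = ∀ i → x i ≡ y i

  _≤ᵥ_ : ∀ {n} → Pt n → Pt n → Set
  x ≤ᵥ y = ∀ i → x i ≤ y i

  _≪_ : ∀ {n} → Pt n → Pt n → Set
  x ≪ y = ∀ i → x i < y i

  _⊆_ : ∀ {n} → PtSet n → PtSet n → Set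
  B ⊆ A = ∀ x → B x → A x

  BoundedAbove : ∀ {n} → PtSet n → Set
  BoundedAbove {n} B = ∃ λ (u : Pt n) → ∀ x → B x → x ≤ᵥ u

  IsSup : ∀ {n} → PtSet n → Pt n → Set
  IsSup B s = ∀ i → IsLUB (λ r → ∃ λ x → B x × x i ≡ r) (s i)

  InFace : ∀ {n} → Pt n → Subset n → Pt n → Set
  InFace c J x = x ≤ᵥ c × (∀ j → j ∈ J → x j ≡ c j)

  Neighborly : ∀ {n} → PtSet n → PtSet n → Set
  Neighborly {n} A B = (∃ λ x → B x) × BoundedAbove B ×
    (∀ (s : Pt n) → IsSup B s → ¬ (∃ λ a → A a × a ≪ s))

  Generic : ∀ {n} → PtSet n → Set₁
  Generic {n} A = ∀ (B : PtSet n) → B ⊆ A → Neighborly A B →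
    ∀ (s : Pt n) → IsSup B s →
    ∀ (J : Subset n) → Nonempty J →
    ∀ x y → A x → A y → InFace s J x → InFace s J y → x ≋ y

-- Apply genericity to the pair B = {x, y}.  Its supremum s satisfies x, y ≤ s ≤ c,
-- so no point of A lies strictly below s (B is A-neighborly), and a coordinate
-- where x or y attains c is squeezed to s: both points lie on the face s − 𝕆ⁿ_J
-- of the bonnet over B, which by genericity holds at most one point of A.
module Submission where

open import Defs
open import Data.Nat using (ℕ)
open import Data.Fin.Subset using (Subset; Nonempty)
open import Data.Product using (Σ; ∃; _×_; _,_; proj₁; proj₂)
open import Data.Sum using (_⊎_; inj₁; inj₂)
open import Relation.Nullary using (¬_)
open import Relation.Binary.PropositionalEquality using (_≡_; refl)
open import Relation.Binary.Structures using (IsTotalOrder)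

module Bonnets (R : RealField) where
  open RealField R
  open Rⁿ R
  open IsTotalOrder isTotalOrder using (antisym) renaming (trans to ≤-trans)

  variable
    n : ℕ
    a b d : ℝ
    A B : PtSet n
    c s x y : Pt n
    J : Subset n

  ≤-squeeze : a ≤ b → b ≤ d → a ≡ d → a ≡ b
  ≤-squeeze a≤b b≤a refl = antisym a≤b b≤a

  <-≤-trans : a < b → b ≤ d → a < d
  <-≤-trans (a≤b , a≢b) b≤d = ≤-trans a≤b b≤d , λ { refl → a≢b (antisym a≤b b≤d) }

  ≪-≤ᵥ-trans : x ≪ y → y ≤ᵥ c → x ≪ c
  ≪-≤ᵥ-trans x≪y y≤c i = <-≤-trans (x≪y i) (y≤c i)

  BelowAll : PtSet n → Pt n → Set
  BelowAll B c = ∀ z → B z → z ≤ᵥ c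

  sup-upper : IsSup B s → B x → x ≤ᵥ s
  sup-upper sup Bx i = proj₁ (sup i) _ (_ , Bx , refl)

  sup-least : IsSup B s → BelowAll B c → s ≤ᵥ c
  sup-least {c = c} sup B≤c i = proj₂ (sup i) (c i) λ { _ (z , Bz , refl) → B≤c z Bz i }

  sup-exists : ∃ B → BoundedAbove B → Σ (Pt n) (IsSup B)
  sup-exists {B = B} (x , Bx) (u , B≤u) = (λ i → proj₁ (lub i)) , (λ i → proj₂ (lub i))
    where
    lub : ∀ i → Σ ℝ (IsLUB (λ r → ∃ λ z → B z × z i ≡ r))
    lub i = complete _ (x i , x , Bx , refl) (u i , λ { _ (z , Bz , refl) → B≤u z Bz i })

  neighborly-below : ∃ B → BelowAll B c → ¬ (∃ λ a → A a × a ≪ c) → Neighborly A B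
  neighborly-below {c = c} ne B≤c noA =
    ne , (c , B≤c) , λ s sup (a , Aa , a≪s) → noA (a , Aa , ≪-≤ᵥ-trans a≪s (sup-least sup B≤c))

  InFace-sup : IsSup B s → BelowAll B c → B x → InFace c J x → InFace s J x
  InFace-sup sup B≤c Bx (_ , x≡c) =
    sup-upper sup Bx , λ j j∈J → ≤-squeeze (sup-upper sup Bx j) (sup-least sup B≤c j) (x≡c j j∈J)

  Pair : Pt n → Pt n → PtSet n
  Pair x y z = z ≡ x ⊎ z ≡ y

  Pair-⊆ : A x → A y → Pair x y ⊆ A
  Pair-⊆ Ax Ay _ (inj₁ refl) = Ax
  Pair-⊆ Ax Ay _ (inj₂ refl) = Ay

  Pair-below : x ≤ᵥ c → y ≤ᵥ c → BelowAll (Pair x y) c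
  Pair-below x≤c y≤c _ (inj₁ refl) = x≤c
  Pair-below x≤c y≤c _ (inj₂ refl) = y≤c

  face-of-empty-cone-unique : Generic A → ¬ (∃ λ a → A a × a ≪ c) → Nonempty J →
    ∀ x y → A x → A y → InFace c J x → InFace c J y → x ≋ y
  face-of-empty-cone-unique {c = c} {J = J} generic noA neJ x y Ax Ay x∈F y∈F =
    generic (Pair x y) (Pair-⊆ Ax Ay) (neighborly-below (x , inj₁ refl) pair≤c noA)
      (proj₁ bonnet) (proj₂ bonnet) J neJ x y Ax Ay
      (InFace-sup (proj₂ bonnet) pair≤c (inj₁ refl) x∈F)
      (InFace-sup (proj₂ bonnet) pair≤c (inj₂ refl) y∈F)
    where
    pair≤c : BelowAll (Pair x y) c
    pair≤c = Pair-below (proj₁ x∈F) (proj₁ y∈F)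
    bonnet : Σ (Pt _) (IsSup (Pair x y))
    bonnet = sup-exists (x , inj₁ refl) (c , pair≤c)

mainTheorem1 : (R : RealField) → let open Rⁿ R in
    ∀ (n : ℕ) (A : PtSet n) → Generic A →
    ∀ (c : Pt n) → ¬ (∃ λ a → A a × a ≪ c) →
    ∀ (J : Subset n) → Nonempty J →
    ∀ x y → A x → A y → InFace c J x → InFace c J y → x ≋ y
mainTheorem1 R n A generic c noA J = Bonnets.face-of-empty-cone-unique R generic noA
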